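{- Let $a_1> a_2> \cdots > a_k\geq 1$, and let $G=S_{\left(a_1^{r_1},a_2^{r_2},\ldots,a_k^{r_k}\right)}$. Then $\operatorname{gon}(G)=\min_{0\leq j\leq k}\left\{\sum_{i=1}^j r_i+a_{j+1}\right\}$, where $a_{k+1}$ is taken to be $1$.
   Context: A banana star $S_{\left(a_1^{r_1},\ldots,a_k^{r_k}\right)}$ is a multigraph whose underlying simple graph is a star: a central vertex $v_0$ adjacent to all other vertices (leaves, pairwise non-adjacent), where exactly $r_i$ leaves are joined to $v_0$ by $a_i$ parallel edges. $\operatorname{gon}$ denotes the divisorial gonality, the minimum degree of a divisor of positive rank in the chip-firing (Baker–Norine) divisor theory. -}

module Defs where

open import Data.Nat as ℕ using (ℕ; zero; suc; _⊓_)
open import Data.Integer as ℤ using (ℤ; +_; _-_; _*_; _≤_; _+_; 0ℤ; 1ℤ)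
open import Data.Fin using (Fin; zero; suc)
open import Data.List using (List; length; lookup; concatMap; replicate; allFin)
open import Data.Product using (Σ; _×_; ∃)
open import Relation.Binary.PropositionalEquality using (_≡_)
open import Relation.Nullary using (yes; no)

-- A finite loopless multigraph on vertex set Fin n:
-- mult v w = number of edges between v and w.
record Multigraph : Set where
  field
    n    : ℕ
    mult : Fin n → Fin n → ℕ
open Multigraph public

ΣFin : (n : ℕ) → (Fin n → ℤ) → ℤ
ΣFin zero    f = 0ℤ
ΣFin (suc n) f = f zero + ΣFin n (λ i → f (suc i))

Divisor : Multigraph → Set
Divisor G = Fin (n G) → ℤ

deg : (G : Multigraph) → Divisor G → ℤ
deg G D = ΣFin (n G) D

Effective : (G : Multigraph) → Divisor G → Set
Effective G D = ∀ v → 0ℤ ≤ D v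

laplacian : (G : Multigraph) → (Fin (n G) → ℤ) → Divisor G
laplacian G f v = ΣFin (n G) (λ w → (+ mult G v w) * (f v - f w))

LinEquiv : (G : Multigraph) → Divisor G → Divisor G → Set
LinEquiv G D D' = Σ (Fin (n G) → ℤ) λ f → ∀ v → D' v ≡ D v - laplacian G f v

χ : (G : Multigraph) → Fin (n G) → Divisor G
χ G v w with Data.Fin._≟_ v w
... | yes _ = 1ℤ
... | no  _ = 0ℤ

-- Baker–Norine rank r(D) ≥ 1: for every vertex v (= effective divisor of
-- degree 1), D - v is linearly equivalent to an effective divisor.
PositiveRank : (G : Multigraph) → Divisor G → Set
PositiveRank G D =
  ∀ v → ∃ λ (E : Divisor G) → Effective G E × LinEquiv G (λ w → D w - χ G v w) E

IsGonality : (G : Multigraph) → ℕ → Set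
IsGonality G m =
  (∃ λ (D : Divisor G) → PositiveRank G D × deg G D ≡ + m)
  × (∀ (D : Divisor G) → PositiveRank G D → + m ≤ deg G D)

leafWeights : (k : ℕ) → (Fin k → ℕ) → (Fin k → ℕ) → List ℕ
leafWeights k a r = concatMap (λ i → replicate (r i) (a i)) (allFin k)

-- star on vertices Fin (1 + #leaves), vertex zero is the centre v₀,
-- leaf l joined to v₀ by (lookup ws l) parallel edges.
starMult : (ws : List ℕ) → Fin (suc (length ws)) → Fin (suc (length ws)) → ℕ
starMult ws zero    zero    = 0
starMult ws zero    (suc l) = lookup ws l
starMult ws (suc l) zero    = lookup ws l
starMult ws (suc l) (suc m) = 0

bananaStar : (k : ℕ) → (Fin k → ℕ) → (Fin k → ℕ) → Multigraph
bananaStar k a r = record { n = suc (length ws) ; mult = starMult ws }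
  where ws = leafWeights k a r

-- a_{j+1} for j = 0..k (0-indexed: aExt a j = a j for j < k, aExt a k = 1)
aExt : {k : ℕ} → (Fin k → ℕ) → Fin (suc k) → ℕ
aExt {zero}  a zero    = 1
aExt {suc k} a zero    = a zero
aExt {suc k} a (suc j) = aExt (λ i → a (suc i)) j

-- prefix sum: preSum r j = r_1 + ... + r_j (= Σ_{i<j} r i, 0-indexed)
preSum : {k : ℕ} → (Fin k → ℕ) → Fin (suc k) → ℕ
preSum         r zero    = 0
preSum {suc k} r (suc j) = r zero ℕ.+ preSum (λ i → r (suc i)) j

minFin : (n : ℕ) → (Fin (suc n) → ℕ) → ℕ
minFin zero    f = f zero
minFin (suc n) f = f zero ⊓ minFin n (λ i → f (suc i))

gonFormula : (k : ℕ) → (Fin k → ℕ) → (Fin k → ℕ) → ℕ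
gonFormula k a r = minFin k (λ j → preSum r j ℕ.+ aExt a j)

-- Chip-firing on a star never changes the number of chips on a leaf modulo the weight of that leaf.
-- Let D have positive rank and let ν count the leaves whose chip number is not a multiple of their
-- weight. Removing a chip from the centre and passing to an equivalent effective divisor leaves at
-- least one chip on each of these leaves, so deg D ≥ ν + 1. Removing a chip from a leaf l that does
-- carry a multiple of its weight leaves at least wt l − 1 chips on l, so deg D ≥ ν + wt l. Hence for
-- W = deg D − ν every leaf heavier than W is counted by ν, and deg D ≥ W + #{leaves heavier than W}.
-- Conversely W ≥ 1 chips on the centre and one on each leaf heavier than W give a divisor of positive
-- rank: a lighter leaf borrows its weight from the centre. On a banana star the minimum of
-- W + #{leaves heavier than W} over W ≥ 1 is attained at W = a_{j+1} for some j, where it equals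
-- r_1 + ⋯ + r_j + a_{j+1}.

{-# OPTIONS --safe #-}
module Submission where

open import Defs
open import Data.Nat using (ℕ; _<_; _≤_)
open import Data.Fin using (Fin)
import Data.Fin

open import Data.Fin as Fin using (zero; suc; _≟_)
import Data.Fin.Properties as Fin
open import Data.Integer as ℤ using (ℤ; +_; +[1+_]; -_; _+_; _-_; _*_; 0ℤ; 1ℤ; -1ℤ; +≤+; ∣_∣)
import Data.Integer.Properties as ℤ
open import Data.Integer.Divisibility.Signed using (_∣_; divides; _∣?_; ∣m∣n⇒∣m-n; ∣⇒∣ᵤ)
open import Data.Integer.Tactic.RingSolver using (solve-∀)
open import Data.List using (List; []; _∷_; length; lookup; filter; replicate; concat; _++_)
open import Data.List.Properties
  using (filter-++; filter-all; filter-none; filter-accept; filter-reject; length-filter; length-++;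
         length-replicate; map-tabulate)
open import Data.List.Membership.Propositional.Properties using (∈-lookup)
open import Data.List.Relation.Unary.All as All using (All)
open import Data.List.Relation.Unary.All.Properties using (concat⁺; map⁺; tabulate⁺; replicate⁺)
open import Data.Nat as ℕ using (zero; suc; z≤n; s≤s; _<?_; _≤?_)
open import Data.Nat.Divisibility using (∣⇒≤)
import Data.Nat.Properties as ℕ
open import Algebra.Properties.CommutativeSemigroup ℕ.+-commutativeSemigroup using (x∙yz≈y∙xz)
open import Data.Product using (∃; _×_; _,_)
open import Data.Sum using (inj₁; inj₂)
open import Function using (_∘_; id)
open import Relation.Binary.PropositionalEquality
  using (_≡_; _≢_; refl; sym; trans; cong; cong₂; subst; module ≡-Reasoning)
open import Relation.Nullary using (Dec; yes; no; ¬_; ¬?; contradiction)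

𝟙 : {A : Set} → Dec A → ℤ
𝟙 (yes _) = 1ℤ
𝟙 (no _)  = 0ℤ

0≤𝟙 : {A : Set} (d : Dec A) → 0ℤ ℤ.≤ 𝟙 d
0≤𝟙 (yes _) = +≤+ z≤n
0≤𝟙 (no _)  = +≤+ z≤n

𝟙-yes : {A : Set} → A → (d : Dec A) → 𝟙 d ≡ 1ℤ
𝟙-yes a (yes _) = refl
𝟙-yes a (no ¬a) = contradiction a ¬a

𝟙-no : {A : Set} → ¬ A → (d : Dec A) → 𝟙 d ≡ 0ℤ
𝟙-no ¬a (yes a) = contradiction a ¬a
𝟙-no ¬a (no _)  = refl

i≡-i⇒i≡0 : ∀ {i} → i ≡ - i → i ≡ 0ℤ
i≡-i⇒i≡0 {+ zero} _ = refl

i+j≤k⇒j≤k-i : ∀ {i j k} → i + j ℤ.≤ k → j ℤ.≤ k - i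
i+j≤k⇒j≤k-i {i} {j} {k} i+j≤k = subst (ℤ._≤ k - i) (cancel i j) (ℤ.+-monoˡ-≤ (- i) i+j≤k)
  where
  cancel : ∀ i j → (i + j) - i ≡ j
  cancel = solve-∀

i≤j-1⇒i+1≤j : ∀ {i j} → i ℤ.≤ j - 1ℤ → i + 1ℤ ℤ.≤ j
i≤j-1⇒i+1≤j {i} {j} i≤j-1 = subst (i + 1ℤ ℤ.≤_) (cancel j) (ℤ.+-monoˡ-≤ 1ℤ i≤j-1)
  where
  cancel : ∀ j → (j - 1ℤ) + 1ℤ ≡ j
  cancel = solve-∀

∤⇒1≤ : ∀ {w x e} → 0ℤ ℤ.≤ e → w ∣ x - e → ¬ w ∣ x → 1ℤ ℤ.≤ e
∤⇒1≤ {e = + zero}   _ w∣x-0 w∤x = contradiction (subst (_ ∣_) (ℤ.+-identityʳ _) w∣x-0) w∤x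
∤⇒1≤ {e = +[1+ n ]} _ _     _   = +≤+ (s≤s z≤n)

∣⇒w-1≤ : ∀ {w x e} → 0ℤ ℤ.≤ e → + w ∣ (x - 1ℤ) - e → + w ∣ x → + w - 1ℤ ℤ.≤ e
∣⇒w-1≤ {w} {x} {+ n} _ w∣x-1-e w∣x = ℤ.+-monoˡ-≤ -1ℤ (+≤+ (∣⇒≤ (∣⇒∣ᵤ w∣1+e)))
  where
  1+e : ∀ x e → x - ((x - 1ℤ) - e) ≡ 1ℤ + e
  1+e = solve-∀
  w∣1+e : + w ∣ 1ℤ + + n
  w∣1+e = subst (+ w ∣_) (1+e x (+ n)) (∣m∣n⇒∣m-n w∣x w∣x-1-e)

ΣFin-cong : ∀ n {f g : Fin n → ℤ} → (∀ i → f i ≡ g i) → ΣFin n f ≡ ΣFin n g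
ΣFin-cong zero    f≗g = refl
ΣFin-cong (suc n) f≗g = cong₂ _+_ (f≗g zero) (ΣFin-cong n (f≗g ∘ suc))

ΣFin-zero : ∀ n {f : Fin n → ℤ} → (∀ i → f i ≡ 0ℤ) → ΣFin n f ≡ 0ℤ
ΣFin-zero zero    f≗0 = refl
ΣFin-zero (suc n) f≗0 = cong₂ _+_ (f≗0 zero) (ΣFin-zero n (f≗0 ∘ suc))

ΣFin-+ : ∀ n (f g : Fin n → ℤ) → ΣFin n (λ i → f i + g i) ≡ ΣFin n f + ΣFin n g
ΣFin-+ zero    f g = refl
ΣFin-+ (suc n) f g = trans (cong (_+_ (f zero + g zero)) (ΣFin-+ n (f ∘ suc) (g ∘ suc)))
                           (interchange (f zero) (g zero) _ _)
  where
  interchange : ∀ a b c d → (a + b) + (c + d) ≡ (a + c) + (b + d)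
  interchange = solve-∀

ΣFin-neg : ∀ n (f : Fin n → ℤ) → ΣFin n (λ i → - f i) ≡ - ΣFin n f
ΣFin-neg zero    f = refl
ΣFin-neg (suc n) f =
  trans (cong (_+_ (- f zero)) (ΣFin-neg n (f ∘ suc))) (sym (ℤ.neg-distrib-+ (f zero) _))

ΣFin-minus : ∀ n (f g : Fin n → ℤ) → ΣFin n (λ i → f i - g i) ≡ ΣFin n f - ΣFin n g
ΣFin-minus n f g = trans (ΣFin-+ n f (-_ ∘ g)) (cong (_+_ (ΣFin n f)) (ΣFin-neg n g))

ΣFin-mono : ∀ n {f g : Fin n → ℤ} → (∀ i → f i ℤ.≤ g i) → ΣFin n f ℤ.≤ ΣFin n g
ΣFin-mono zero    f≤g = ℤ.≤-refl
ΣFin-mono (suc n) f≤g = ℤ.+-mono-≤ (f≤g zero) (ΣFin-mono n (f≤g ∘ suc))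

ΣFin-swap : ∀ m n (g : Fin m → Fin n → ℤ) →
            ΣFin m (λ i → ΣFin n (g i)) ≡ ΣFin n (λ j → ΣFin m (λ i → g i j))
ΣFin-swap zero    n g = sym (ΣFin-zero n (λ _ → refl))
ΣFin-swap (suc m) n g = begin
  ΣFin n (g zero) + ΣFin m (λ i → ΣFin n (g (suc i)))
    ≡⟨ cong (_+_ (ΣFin n (g zero))) (ΣFin-swap m n (g ∘ suc)) ⟩
  ΣFin n (g zero) + ΣFin n (λ j → ΣFin m (λ i → g (suc i) j))
    ≡⟨ ΣFin-+ n (g zero) _ ⟨
  ΣFin n (λ j → g zero j + ΣFin m (λ i → g (suc i) j))
    ∎
  where open ≡-Reasoning

ΣFin-supported : ∀ n (f : Fin n → ℤ) m → (∀ i → i ≢ m → f i ≡ 0ℤ) → ΣFin n f ≡ f m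
ΣFin-supported (suc n) f zero    f≗0 =
  trans (cong (_+_ (f zero)) (ΣFin-zero n (λ i → f≗0 (suc i) (λ ())))) (ℤ.+-identityʳ (f zero))
ΣFin-supported (suc n) f (suc m) f≗0 =
  trans (cong₂ _+_ (f≗0 zero (λ ()))
                   (ΣFin-supported n (f ∘ suc) m (λ i i≢m → f≗0 (suc i) (i≢m ∘ Fin.suc-injective))))
        (ℤ.+-identityˡ (f (suc m)))

Undirected : Multigraph → Set
Undirected G = ∀ v w → mult G v w ≡ mult G w v

Winnable : (G : Multigraph) → Divisor G → Set
Winnable G D = ∃ λ (E : Divisor G) → Effective G E × LinEquiv G D E

module _ (G : Multigraph) where

  χ-self : ∀ v → χ G v v ≡ 1ℤ
  χ-self v with v ≟ v
  ... | yes _   = refl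
  ... | no v≢v = contradiction refl v≢v

  χ-other : ∀ {v w} → v ≢ w → χ G v w ≡ 0ℤ
  χ-other {v} {w} v≢w with v ≟ w
  ... | yes v≡w = contradiction v≡w v≢w
  ... | no _    = refl

  deg-χ : ∀ v → deg G (χ G v) ≡ 1ℤ
  deg-χ v = trans (ΣFin-supported (n G) (χ G v) v (λ w w≢v → χ-other (w≢v ∘ sym))) (χ-self v)

  deg-minus-χ : ∀ D v → deg G (λ w → D w - χ G v w) ≡ deg G D - 1ℤ
  deg-minus-χ D v = trans (ΣFin-minus (n G) D (χ G v)) (cong (_-_ (deg G D)) (deg-χ v))

  -- Swapping the order of summation turns the double sum into its own negative.
  deg-laplacian : Undirected G → ∀ f → deg G (laplacian G f) ≡ 0ℤ
  deg-laplacian undirected f = i≡-i⇒i≡0 (begin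
    ΣFin (n G) (λ v → ΣFin (n G) (flow v))
      ≡⟨ ΣFin-swap (n G) (n G) flow ⟩
    ΣFin (n G) (λ w → ΣFin (n G) (λ v → flow v w))
      ≡⟨ ΣFin-cong (n G) (λ w → ΣFin-cong (n G) (λ v → flow-antisym v w)) ⟩
    ΣFin (n G) (λ w → ΣFin (n G) (λ v → - flow w v))
      ≡⟨ ΣFin-cong (n G) (λ w → ΣFin-neg (n G) (flow w)) ⟩
    ΣFin (n G) (λ w → - ΣFin (n G) (flow w))
      ≡⟨ ΣFin-neg (n G) _ ⟩
    - ΣFin (n G) (λ w → ΣFin (n G) (flow w))
      ∎)
    where
    open ≡-Reasoning
    flow : Fin (n G) → Fin (n G) → ℤ
    flow v w = + mult G v w * (f v - f w)
    antisym : ∀ m x y → m * (x - y) ≡ - (m * (y - x))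
    antisym = solve-∀
    flow-antisym : ∀ v w → flow v w ≡ - flow w v
    flow-antisym v w =
      trans (cong (λ m → + m * (f v - f w)) (undirected v w)) (antisym (+ mult G w v) (f v) (f w))

  deg-linEquiv : Undirected G → ∀ {D E} → LinEquiv G D E → deg G E ≡ deg G D
  deg-linEquiv undirected {D} {E} (f , E≡D-Δf) = begin
    deg G E                                   ≡⟨ ΣFin-cong (n G) E≡D-Δf ⟩
    ΣFin (n G) (λ w → D w - laplacian G f w)  ≡⟨ ΣFin-minus (n G) D (laplacian G f) ⟩
    deg G D - deg G (laplacian G f)           ≡⟨ cong (_-_ (deg G D)) (deg-laplacian undirected f) ⟩
    deg G D - 0ℤ                              ≡⟨ ℤ.+-identityʳ (deg G D) ⟩
    deg G D                                   ∎
    where open ≡-Reasoning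

  effective⇒winnable : ∀ {D} → Effective G D → Winnable G D
  effective⇒winnable {D} D≥0 = D , D≥0 , (λ _ → 0ℤ) , λ w → sym (begin
    D w - laplacian G (λ _ → 0ℤ) w
      ≡⟨ cong (_-_ (D w)) (ΣFin-zero (n G) (λ u → ℤ.*-zeroʳ (+ mult G w u))) ⟩
    D w - 0ℤ
      ≡⟨ ℤ.+-identityʳ (D w) ⟩
    D w
      ∎)
    where open ≡-Reasoning

  effective-minus-χ : ∀ {D v} → Effective G D → 1ℤ ℤ.≤ D v → Effective G (λ w → D w - χ G v w)
  effective-minus-χ {D} {v} D≥0 1≤Dv w with v ≟ w
  ... | yes refl = ℤ.i≤j⇒0≤j-i 1≤Dv
  ... | no _     = subst (0ℤ ℤ.≤_) (sym (ℤ.+-identityʳ (D w))) (D≥0 w)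

countAbove : ℕ → List ℕ → ℕ
countAbove W ws = length (filter (W <?_) ws)

ΣFin-𝟙-above : ∀ W ws → ΣFin (length ws) (λ l → 𝟙 (W <? lookup ws l)) ≡ + countAbove W ws
ΣFin-𝟙-above W []       = refl
ΣFin-𝟙-above W (x ∷ xs) with W <? x
... | yes W<x = trans (cong (_+_ 1ℤ) (ΣFin-𝟙-above W xs))
                      (cong (+_ ∘ length) (sym (filter-accept (W <?_) W<x)))
... | no W≮x  = trans (ℤ.+-identityˡ _)
                      (trans (ΣFin-𝟙-above W xs) (cong (+_ ∘ length) (sym (filter-reject (W <?_) W≮x))))

star : List ℕ → Multigraph
star ws = record { n = suc (length ws) ; mult = starMult ws }

star-undirected : ∀ ws → Undirected (star ws)
star-undirected ws zero    zero    = refl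
star-undirected ws zero    (suc _) = refl
star-undirected ws (suc _) zero    = refl
star-undirected ws (suc _) (suc _) = refl

module Star (ws : List ℕ) where

  private
    G : Multigraph
    G = star ws
    N : ℕ
    N = length ws
    wt : Fin N → ℕ
    wt = lookup ws

  χ-leaf-other : ∀ {l m} → l ≢ m → χ G (suc m) (suc l) ≡ 0ℤ
  χ-leaf-other l≢m = χ-other G (l≢m ∘ sym ∘ Fin.suc-injective)

  laplacian-centre : ∀ f → laplacian G f zero ≡ ΣFin N (λ l → + wt l * (f zero - f (suc l)))
  laplacian-centre f = ℤ.+-identityˡ _

  laplacian-leaf : ∀ f l → laplacian G f (suc l) ≡ + wt l * (f (suc l) - f zero)
  laplacian-leaf f l =
    trans (cong (_+_ (+ wt l * (f (suc l) - f zero))) (ΣFin-zero N (λ _ → refl))) (ℤ.+-identityʳ _)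

  linEquiv-leaf : ∀ {D E} → LinEquiv G D E → ∀ l → + wt l ∣ D (suc l) - E (suc l)
  linEquiv-leaf {D} {E} (f , E≡D-Δf) l = divides (f (suc l) - f zero) (begin
    D (suc l) - E (suc l)
      ≡⟨ cong (_-_ (D (suc l))) (trans (E≡D-Δf (suc l)) (cong (_-_ (D (suc l))) (laplacian-leaf f l))) ⟩
    D (suc l) - (D (suc l) - + wt l * (f (suc l) - f zero))
      ≡⟨ cancel (D (suc l)) (+ wt l) (f (suc l) - f zero) ⟩
    (f (suc l) - f zero) * + wt l
      ∎)
    where
    open ≡-Reasoning
    cancel : ∀ d w q → d - (d - w * q) ≡ q * w
    cancel = solve-∀

  ΣFin-plus-leafχ : ∀ (g : Fin N → ℤ) c m → ΣFin N (λ l → g l + c * χ G (suc m) (suc l)) ≡ ΣFin N g + c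
  ΣFin-plus-leafχ g c m = begin
    ΣFin N (λ l → g l + c * χ G (suc m) (suc l))      ≡⟨ ΣFin-+ N g _ ⟩
    ΣFin N g + ΣFin N (λ l → c * χ G (suc m) (suc l)) ≡⟨ cong (_+_ (ΣFin N g)) (ΣFin-supported N _ m elsewhere) ⟩
    ΣFin N g + c * χ G (suc m) (suc m)                ≡⟨ cong (λ x → ΣFin N g + c * x) (χ-self G (suc m)) ⟩
    ΣFin N g + c * 1ℤ                                 ≡⟨ cong (_+_ (ΣFin N g)) (ℤ.*-identityʳ c) ⟩
    ΣFin N g + c                                      ∎
    where
    open ≡-Reasoning
    elsewhere : ∀ l → l ≢ m → c * χ G (suc m) (suc l) ≡ 0ℤ
    elsewhere l l≢m = trans (cong (c *_) (χ-leaf-other l≢m)) (ℤ.*-zeroʳ c)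

  nonMultipleAt : Divisor G → Fin N → ℤ
  nonMultipleAt D l = 𝟙 (¬? (+ wt l ∣? D (suc l)))

  nonMultipleLeaves : Divisor G → ℤ
  nonMultipleLeaves D = ΣFin N (nonMultipleAt D)

  module Removal (D : Divisor G) (v : Fin (suc N)) {E : Divisor G}
                 (E≥0 : Effective G E) (D-v~E : LinEquiv G (λ w → D w - χ G v w) E) where

    ΣFin-leafBound+1≤deg : (b : Fin N → ℤ) → (∀ l → b l ℤ.≤ E (suc l)) →
                           ΣFin N b + 1ℤ ℤ.≤ deg G D
    ΣFin-leafBound+1≤deg b b≤E = i≤j-1⇒i+1≤j (begin
      ΣFin N b                     ≤⟨ ΣFin-mono N b≤E ⟩
      ΣFin N (E ∘ suc)             ≡⟨ ℤ.+-identityˡ _ ⟨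
      0ℤ + ΣFin N (E ∘ suc)        ≤⟨ ℤ.+-monoˡ-≤ _ (E≥0 zero) ⟩
      deg G E                      ≡⟨ deg-linEquiv G (star-undirected ws) {λ w → D w - χ G v w} {E} D-v~E ⟩
      deg G (λ w → D w - χ G v w)  ≡⟨ deg-minus-χ G D v ⟩
      deg G D - 1ℤ                 ∎)
      where open ℤ.≤-Reasoning

    residue : ∀ l → + wt l ∣ (D (suc l) - χ G v (suc l)) - E (suc l)
    residue = linEquiv-leaf {λ w → D w - χ G v w} {E} D-v~E

    nonMultipleAt≤E : ∀ {l} → v ≢ suc l → nonMultipleAt D l ℤ.≤ E (suc l)
    nonMultipleAt≤E {l} v≢l with + wt l ∣? D (suc l)
    ... | yes _   = E≥0 (suc l)
    ... | no w∤D = ∤⇒1≤ (E≥0 (suc l)) (subst (λ x → + wt l ∣ x - E (suc l)) D-v≡D (residue l)) w∤D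
      where
      D-v≡D : D (suc l) - χ G v (suc l) ≡ D (suc l)
      D-v≡D = trans (cong (_-_ (D (suc l))) (χ-other G v≢l)) (ℤ.+-identityʳ (D (suc l)))

    wt-1≤E : ∀ {l} → v ≡ suc l → + wt l ∣ D (suc l) → + wt l - 1ℤ ℤ.≤ E (suc l)
    wt-1≤E {l} refl w∣D = ∣⇒w-1≤ (E≥0 (suc l)) w∣D-1-E w∣D
      where
      w∣D-1-E : + wt l ∣ (D (suc l) - 1ℤ) - E (suc l)
      w∣D-1-E = subst (λ c → + wt l ∣ (D (suc l) - c) - E (suc l)) (χ-self G v) (residue l)

  nonMultipleLeaves+1≤deg : ∀ {D} → Winnable G (λ w → D w - χ G zero w) →
                            nonMultipleLeaves D + 1ℤ ℤ.≤ deg G D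
  nonMultipleLeaves+1≤deg {D} (E , E≥0 , D-v~E) =
    ΣFin-leafBound+1≤deg (nonMultipleAt D) (λ l → nonMultipleAt≤E (λ ()))
    where open Removal D zero E≥0 D-v~E

  nonMultipleLeaves+wt≤deg : ∀ {D m} → Winnable G (λ w → D w - χ G (suc m) w) → + wt m ∣ D (suc m) →
                             nonMultipleLeaves D + + wt m ℤ.≤ deg G D
  nonMultipleLeaves+wt≤deg {D} {m} (E , E≥0 , D-m~E) w∣D =
    subst (ℤ._≤ deg G D) Σb+1≡ν+w (ΣFin-leafBound+1≤deg b b≤E)
    where
    open Removal D (suc m) E≥0 D-m~E
    c : ℤ
    c = + wt m - 1ℤ
    b : Fin N → ℤ
    b l = nonMultipleAt D l + c * χ G (suc m) (suc l)
    b≤E : ∀ l → b l ℤ.≤ E (suc l)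
    b≤E l with l ≟ m
    ... | yes refl = begin
      nonMultipleAt D l + c * χ G (suc l) (suc l)
        ≡⟨ cong₂ (λ x y → x + c * y) (𝟙-no (λ w∤D → w∤D w∣D) (¬? (+ wt l ∣? D (suc l))))
                                     (χ-self G (suc l)) ⟩
      0ℤ + c * 1ℤ  ≡⟨ trans (ℤ.+-identityˡ (c * 1ℤ)) (ℤ.*-identityʳ c) ⟩
      c            ≤⟨ wt-1≤E refl w∣D ⟩
      E (suc l)    ∎
      where open ℤ.≤-Reasoning
    ... | no l≢m = begin
      nonMultipleAt D l + c * χ G (suc m) (suc l)
        ≡⟨ cong (λ y → nonMultipleAt D l + c * y) (χ-leaf-other l≢m) ⟩
      nonMultipleAt D l + c * 0ℤ
        ≡⟨ cong (_+_ (nonMultipleAt D l)) (ℤ.*-zeroʳ c) ⟩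
      nonMultipleAt D l + 0ℤ
        ≡⟨ ℤ.+-identityʳ _ ⟩
      nonMultipleAt D l
        ≤⟨ nonMultipleAt≤E (l≢m ∘ sym ∘ Fin.suc-injective) ⟩
      E (suc l)
        ∎
      where open ℤ.≤-Reasoning
    Σb+1≡ν+w : ΣFin N b + 1ℤ ≡ nonMultipleLeaves D + + wt m
    Σb+1≡ν+w = trans (cong (_+ 1ℤ) (ΣFin-plus-leafχ (nonMultipleAt D) c m)) (shift (nonMultipleLeaves D) (+ wt m))
      where
      shift : ∀ ν w → (ν + (w - 1ℤ)) + 1ℤ ≡ ν + w
      shift = solve-∀

  positiveRank⇒heavyBound : ∀ {D} → PositiveRank G D →
                            ∃ λ W → 1 ≤ W × + (W ℕ.+ countAbove W ws) ℤ.≤ deg G D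
  positiveRank⇒heavyBound {D} rank = W , 1≤W , (begin
    + W + + countAbove W ws  ≤⟨ ℤ.+-monoʳ-≤ (+ W) heavy≤ν ⟩
    + W + ν                  ≡⟨ cong (_+ ν) +W≡d-ν ⟩
    (deg G D - ν) + ν        ≡⟨ cancel (deg G D) ν ⟩
    deg G D                  ∎)
    where
    open ℤ.≤-Reasoning
    cancel : ∀ d ν → (d - ν) + ν ≡ d
    cancel = solve-∀
    ν : ℤ
    ν = nonMultipleLeaves D
    1≤d-ν : 1ℤ ℤ.≤ deg G D - ν
    1≤d-ν = i+j≤k⇒j≤k-i {ν} (nonMultipleLeaves+1≤deg {D} (rank zero))
    W : ℕ
    W = ∣ deg G D - ν ∣
    +W≡d-ν : + W ≡ deg G D - ν
    +W≡d-ν = ℤ.0≤i⇒+∣i∣≡i (ℤ.≤-trans (+≤+ z≤n) 1≤d-ν)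
    1≤W : 1 ≤ W
    1≤W = ℤ.drop‿+≤+ (subst (1ℤ ℤ.≤_) (sym +W≡d-ν) 1≤d-ν)
    multiple⇒wt≤W : ∀ {l} → + wt l ∣ D (suc l) → wt l ≤ W
    multiple⇒wt≤W {l} w∣D = ℤ.drop‿+≤+ (subst (+ wt l ℤ.≤_) (sym +W≡d-ν) (i+j≤k⇒j≤k-i {ν} ν+w≤d))
      where
      ν+w≤d : ν + + wt l ℤ.≤ deg G D
      ν+w≤d = nonMultipleLeaves+wt≤deg {D} (rank (suc l)) w∣D
    heavy⇒nonMultiple : ∀ l → 𝟙 (W <? wt l) ℤ.≤ nonMultipleAt D l
    heavy⇒nonMultiple l with W <? wt l
    ... | no _    = 0≤𝟙 (¬? (+ wt l ∣? D (suc l)))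
    ... | yes W<w = ℤ.≤-reflexive (sym (𝟙-yes w∤D (¬? (+ wt l ∣? D (suc l)))))
      where
      w∤D : ¬ (+ wt l ∣ D (suc l))
      w∤D w∣D = ℕ.<⇒≱ W<w (multiple⇒wt≤W w∣D)
    heavy≤ν : + countAbove W ws ℤ.≤ ν
    heavy≤ν = subst (ℤ._≤ ν) (ΣFin-𝟙-above W ws) (ΣFin-mono N heavy⇒nonMultiple)

  heavyDivisor : ℕ → Divisor G
  heavyDivisor W zero    = + W
  heavyDivisor W (suc l) = 𝟙 (W <? wt l)

  deg-heavyDivisor : ∀ W → deg G (heavyDivisor W) ≡ + (W ℕ.+ countAbove W ws)
  deg-heavyDivisor W = cong (_+_ (+ W)) (ΣFin-𝟙-above W ws)

  heavyDivisor-effective : ∀ W → Effective G (heavyDivisor W)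
  heavyDivisor-effective W zero    = +≤+ z≤n
  heavyDivisor-effective W (suc l) = 0≤𝟙 (W <? wt l)

  borrowing : Fin N → Fin (suc N) → ℤ
  borrowing l w = - χ G (suc l) w

  -- Since suc l ≟ zero reduces to no, borrowing l vanishes at the centre by computation.
  laplacian-borrowing-centre : ∀ l → laplacian G (borrowing l) zero ≡ + wt l
  laplacian-borrowing-centre l = begin
    laplacian G (borrowing l) zero
      ≡⟨ laplacian-centre (borrowing l) ⟩
    ΣFin N (λ l' → + wt l' * (0ℤ - - χ G (suc l) (suc l')))
      ≡⟨ ΣFin-supported N _ l elsewhere ⟩
    + wt l * (0ℤ - - χ G (suc l) (suc l))
      ≡⟨ cong (λ x → + wt l * (0ℤ - - x)) (χ-self G (suc l)) ⟩
    + wt l * 1ℤ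
      ≡⟨ ℤ.*-identityʳ (+ wt l) ⟩
    + wt l
      ∎
    where
    open ≡-Reasoning
    elsewhere : ∀ l' → l' ≢ l → + wt l' * (0ℤ - - χ G (suc l) (suc l')) ≡ 0ℤ
    elsewhere l' l'≢l = trans (cong (λ x → + wt l' * (0ℤ - - x)) (χ-leaf-other l'≢l)) (ℤ.*-zeroʳ (+ wt l'))

  leaf-borrows : ∀ {D l} → Effective G D → + wt l ℤ.≤ D zero → 1 ≤ wt l →
                 Winnable G (λ w → D w - χ G (suc l) w)
  leaf-borrows {D} {l} D≥0 w≤D₀ 1≤w = E , E≥0 , borrowing l , (λ _ → refl)
    where
    E : Divisor G
    E w = (D w - χ G (suc l) w) - laplacian G (borrowing l) w
    E-leaf : ∀ l' → E (suc l') ≡ D (suc l') + (+ wt l' - 1ℤ) * χ G (suc l) (suc l')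
    E-leaf l' = trans (cong (_-_ (D (suc l') - χ G (suc l) (suc l'))) (laplacian-leaf (borrowing l) l'))
                      (borrow (D (suc l')) (+ wt l') (χ G (suc l) (suc l')))
      where
      borrow : ∀ d w x → (d - x) - w * (- x - 0ℤ) ≡ d + (w - 1ℤ) * x
      borrow = solve-∀
    0≤gain : ∀ l' → 0ℤ ℤ.≤ (+ wt l' - 1ℤ) * χ G (suc l) (suc l')
    0≤gain l' with l' ≟ l
    ... | yes refl =
      subst (0ℤ ℤ.≤_) (sym (trans (cong ((+ wt l - 1ℤ) *_) (χ-self G (suc l))) (ℤ.*-identityʳ _)))
            (ℤ.i≤j⇒0≤j-i (+≤+ 1≤w))
    ... | no l'≢l  =
      ℤ.≤-reflexive (sym (trans (cong ((+ wt l' - 1ℤ) *_) (χ-leaf-other l'≢l)) (ℤ.*-zeroʳ (+ wt l' - 1ℤ))))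
    E≥0 : Effective G E
    E≥0 zero     =
      subst (0ℤ ℤ.≤_) (sym (cong₂ _-_ (ℤ.+-identityʳ (D zero)) (laplacian-borrowing-centre l))) (ℤ.i≤j⇒0≤j-i w≤D₀)
    E≥0 (suc l') = subst (0ℤ ℤ.≤_) (sym (E-leaf l')) (ℤ.+-mono-≤ (D≥0 (suc l')) (0≤gain l'))

  heavyDivisor-positiveRank : All (1 ≤_) ws → ∀ {W} → 1 ≤ W → PositiveRank G (heavyDivisor W)
  heavyDivisor-positiveRank _ {W} 1≤W zero =
    effective⇒winnable G (effective-minus-χ G (heavyDivisor-effective W) (+≤+ 1≤W))
  heavyDivisor-positiveRank 1≤ws {W} 1≤W (suc l) with W <? wt l
  ... | yes W<w = effective⇒winnable G (effective-minus-χ G (heavyDivisor-effective W)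
                                          (ℤ.≤-reflexive (sym (𝟙-yes W<w (W <? wt l)))))
  ... | no W≮w  =
    leaf-borrows (heavyDivisor-effective W) (+≤+ (ℕ.≮⇒≥ W≮w)) (All.lookup 1≤ws (∈-lookup l))

  isGonality : ∀ {m} → All (1 ≤_) ws →
               (∃ λ W → 1 ≤ W × W ℕ.+ countAbove W ws ≡ m) →
               (∀ W → 1 ≤ W → m ≤ W ℕ.+ countAbove W ws) →
               IsGonality G m
  isGonality {m} 1≤ws (W , 1≤W , W+c≡m) minimal =
      (heavyDivisor W , heavyDivisor-positiveRank 1≤ws 1≤W , trans (deg-heavyDivisor W) (cong +_ W+c≡m))
    , lower
    where
    lower : ∀ D → PositiveRank G D → + m ℤ.≤ deg G D
    lower D rank = let W' , 1≤W' , bound = positiveRank⇒heavyBound {D} rank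
                   in ℤ.≤-trans (+≤+ (minimal W' 1≤W')) bound

countAbove-++ : ∀ W xs ys → countAbove W (xs ++ ys) ≡ countAbove W xs ℕ.+ countAbove W ys
countAbove-++ W xs ys = trans (cong length (filter-++ (W <?_) xs ys)) (length-++ (filter (W <?_) xs))

countAbove-replicate : ∀ {W x} n → W < x → countAbove W (replicate n x) ≡ n
countAbove-replicate n W<x = trans (cong length (filter-all (_ <?_) (replicate⁺ n W<x))) (length-replicate n)

countAbove-replicate-≤ : ∀ W x n → countAbove W (replicate n x) ≤ n
countAbove-replicate-≤ W x n =
  ℕ.≤-trans (length-filter (W <?_) (replicate n x)) (ℕ.≤-reflexive (length-replicate n))

countAbove-all≤ : ∀ {W xs} → All (_≤ W) xs → countAbove W xs ≡ 0
countAbove-all≤ xs≤W = cong length (filter-none (_ <?_) (All.map ℕ.≤⇒≯ xs≤W))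

leafWeights-all : ∀ {P : ℕ → Set} k (a r : Fin k → ℕ) → (∀ i → P (a i)) → All P (leafWeights k a r)
leafWeights-all k a r Pa = concat⁺ (map⁺ (tabulate⁺ (λ i → replicate⁺ (r i) (Pa i))))

leafWeights-suc : ∀ k (a r : Fin (suc k) → ℕ) →
                  leafWeights (suc k) a r ≡ replicate (r zero) (a zero) ++ leafWeights k (a ∘ suc) (r ∘ suc)
leafWeights-suc k a r = cong (λ xss → replicate (r zero) (a zero) ++ concat xss)
                             (trans (map-tabulate suc block) (sym (map-tabulate id (block ∘ suc))))
  where
  block : Fin (suc k) → List ℕ
  block i = replicate (r i) (a i)

countAbove-leafWeights-suc : ∀ W k (a r : Fin (suc k) → ℕ) →
                             countAbove W (leafWeights (suc k) a r)
                             ≡ countAbove W (replicate (r zero) (a zero))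
                               ℕ.+ countAbove W (leafWeights k (a ∘ suc) (r ∘ suc))
countAbove-leafWeights-suc W k a r =
  trans (cong (countAbove W) (leafWeights-suc k a r)) (countAbove-++ W (replicate (r zero) (a zero)) _)

gonTerm≤W+countAbove : ∀ k (a r : Fin k → ℕ) W → 1 ≤ W →
                       ∃ λ j → preSum r j ℕ.+ aExt a j ≤ W ℕ.+ countAbove W (leafWeights k a r)
gonTerm≤W+countAbove zero    a r W 1≤W = zero , ℕ.≤-trans 1≤W (ℕ.m≤m+n W 0)
gonTerm≤W+countAbove (suc k) a r W 1≤W with a zero ≤? W
... | yes a₀≤W = zero , ℕ.≤-trans a₀≤W (ℕ.m≤m+n W _)
... | no a₀≰W  =
  let j , bound = gonTerm≤W+countAbove k (a ∘ suc) (r ∘ suc) W 1≤W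
      c = countAbove W (leafWeights k (a ∘ suc) (r ∘ suc))
  in suc j , (begin
    (r zero ℕ.+ preSum (r ∘ suc) j) ℕ.+ aExt (a ∘ suc) j  ≡⟨ ℕ.+-assoc (r zero) _ _ ⟩
    r zero ℕ.+ (preSum (r ∘ suc) j ℕ.+ aExt (a ∘ suc) j)  ≤⟨ ℕ.+-monoʳ-≤ (r zero) bound ⟩
    r zero ℕ.+ (W ℕ.+ c)                                  ≡⟨ x∙yz≈y∙xz (r zero) W c ⟩
    W ℕ.+ (r zero ℕ.+ c)
      ≡⟨ cong (λ x → W ℕ.+ (x ℕ.+ c)) (countAbove-replicate (r zero) (ℕ.≰⇒> a₀≰W)) ⟨
    W ℕ.+ (countAbove W (replicate (r zero) (a zero)) ℕ.+ c)
      ≡⟨ cong (W ℕ.+_) (countAbove-leafWeights-suc W k a r) ⟨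
    W ℕ.+ countAbove W (leafWeights (suc k) a r)          ∎)
  where open ℕ.≤-Reasoning

countAbove-aExt≤preSum : ∀ k (a r : Fin k → ℕ) → (∀ (i j : Fin k) → i Data.Fin.< j → a j < a i) →
                         ∀ j → countAbove (aExt a j) (leafWeights k a r) ≤ preSum r j
countAbove-aExt≤preSum zero    a r decreasing zero    = z≤n
countAbove-aExt≤preSum (suc k) a r decreasing zero    =
  ℕ.≤-reflexive (countAbove-all≤ (leafWeights-all (suc k) a r a≤a₀))
  where
  a≤a₀ : ∀ i → a i ≤ a zero
  a≤a₀ zero    = ℕ.≤-refl
  a≤a₀ (suc i) = ℕ.<⇒≤ (decreasing zero (suc i) (s≤s z≤n))
countAbove-aExt≤preSum (suc k) a r decreasing (suc j) = begin
  countAbove W (leafWeights (suc k) a r)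
    ≡⟨ countAbove-leafWeights-suc W k a r ⟩
  countAbove W (replicate (r zero) (a zero)) ℕ.+ countAbove W (leafWeights k (a ∘ suc) (r ∘ suc))
    ≤⟨ ℕ.+-mono-≤ (countAbove-replicate-≤ W (a zero) (r zero))
                  (countAbove-aExt≤preSum k (a ∘ suc) (r ∘ suc) decreasing-tail j) ⟩
  r zero ℕ.+ preSum (r ∘ suc) j
    ∎
  where
  open ℕ.≤-Reasoning
  W : ℕ
  W = aExt (a ∘ suc) j
  decreasing-tail : ∀ (i i' : Fin k) → i Data.Fin.< i' → a (suc i') < a (suc i)
  decreasing-tail i i' i<i' = decreasing (suc i) (suc i') (s≤s i<i')

aExt-positive : ∀ k (a : Fin k → ℕ) → (∀ i → 1 ≤ a i) → ∀ j → 1 ≤ aExt a j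
aExt-positive zero    a 1≤a zero    = s≤s z≤n
aExt-positive (suc k) a 1≤a zero    = 1≤a zero
aExt-positive (suc k) a 1≤a (suc j) = aExt-positive k (a ∘ suc) (1≤a ∘ suc) j

minFin-≤ : ∀ n (f : Fin (suc n) → ℕ) j → minFin n f ≤ f j
minFin-≤ zero    f zero    = ℕ.≤-refl
minFin-≤ (suc n) f zero    = ℕ.m⊓n≤m _ _
minFin-≤ (suc n) f (suc j) = ℕ.≤-trans (ℕ.m⊓n≤n _ _) (minFin-≤ n (f ∘ suc) j)

minFin-attained : ∀ n (f : Fin (suc n) → ℕ) → ∃ λ j → minFin n f ≡ f j
minFin-attained zero    f = zero , refl
minFin-attained (suc n) f with ℕ.⊓-sel (f zero) (minFin n (f ∘ suc))
... | inj₁ min≡f₀   = zero , min≡f₀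
... | inj₂ min≡rest = let j , rest≡fj = minFin-attained n (f ∘ suc) in suc j , trans min≡rest rest≡fj

gonFormula-minimal : ∀ k (a r : Fin k → ℕ) W → 1 ≤ W →
                     gonFormula k a r ≤ W ℕ.+ countAbove W (leafWeights k a r)
gonFormula-minimal k a r W 1≤W =
  let j , bound = gonTerm≤W+countAbove k a r W 1≤W
  in ℕ.≤-trans (minFin-≤ k _ j) bound

gonFormula-attained : ∀ k (a r : Fin k → ℕ) → (∀ (i j : Fin k) → i Data.Fin.< j → a j < a i) →
                      (∀ i → 1 ≤ a i) →
                      ∃ λ W → 1 ≤ W × W ℕ.+ countAbove W (leafWeights k a r) ≡ gonFormula k a r
gonFormula-attained k a r decreasing 1≤a =
  let j , gon≡term = minFin-attained k (λ j → preSum r j ℕ.+ aExt a j)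
      W = aExt a j
      1≤W = aExt-positive k a 1≤a j
  in W , 1≤W , ℕ.≤-antisym
       (begin
         W ℕ.+ countAbove W (leafWeights k a r)
           ≤⟨ ℕ.+-monoʳ-≤ W (countAbove-aExt≤preSum k a r decreasing j) ⟩
         W ℕ.+ preSum r j
           ≡⟨ ℕ.+-comm W (preSum r j) ⟩
         preSum r j ℕ.+ W
           ≡⟨ gon≡term ⟨
         gonFormula k a r
           ∎)
       (gonFormula-minimal k a r W 1≤W)
  where open ℕ.≤-Reasoning

theorem3p3 : (k : ℕ) (a r : Fin k → ℕ)
    → (∀ (i j : Fin k) → i Data.Fin.< j → a j < a i)
    → (∀ (i : Fin k) → 1 ≤ a i)
    → (∀ (i : Fin k) → 1 ≤ r i)
    → IsGonality (bananaStar k a r) (gonFormula k a r)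
theorem3p3 k a r decreasing 1≤a _ =
  Star.isGonality (leafWeights k a r) (leafWeights-all k a r 1≤a)
    (gonFormula-attained k a r decreasing 1≤a) (gonFormula-minimal k a r)
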